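{- Let $G$ be a connected graph with vertex set $\{1,\dots,n\}$, $n\ge 2$, let $\Phi=(F_1,\dots,F_n)$ be an $n$-tuple of pairwise disjoint graphs with $|V(F_i)|\ge 2$ for all $i$, and let $G[\Phi]$ be the generalized lexicographic product. Let $\mu\in\{\gamma,\gamma_t\}$ and let $D$ be a $\mu$-set of $G[\Phi]$. Then: (i) $|D\cap V(F_i)|\le 2$ for all $i$. If $|D\cap V(F_s)|=2$ for some $s$, then no vertex of $F_s$ is adjacent to a vertex of $D\setminus V(F_s)$, and $D\cap V(F_s)$ is a $\mu$-set of $F_s$. If $|D\cap V(F_i)|=|D\cap V(F_j)|=2$ with $i\ne j$, then the distance in $G[\Phi]$ between any vertex of $F_i$ and any vertex of $F_j$ is at least three. (ii) Suppose $R=\{i: |D\cap V(F_i)|=2\}\neq\emptyset$. For $i\in R$ write $D\cap V(F_i)=\{z_{i1},z_{i2}\}$ and choose a neighbor $x_i$ of $z_{i2}$ in $G[\Phi]$ with $x_i\notin V(F_i)$. Then $D^*=(D\setminus\bigcup_{i\in R}\{z_{i2}\})\cup\bigcup_{i\in R}\{x_i\}$ is a $\mu$-set of $G[\Phi]$ and $|D^*\cap V(F_r)|\le 1$ for all $r\in[n]$. (iii) $G[\Phi]$ has a $\mu$-set $U$ such that (a) $|U\cap V(F_i)|\le 1$ for all $i$; (b) if $\mu=\gamma$, then $U$ is both a $\gamma_r$-set and a $\gamma^{oc}$-set of $G[\Phi]$; (c) if $\mu=\gamma_t$, then $U$ is both a $\gamma_{tr}$-set and a $\gamma_t^{oc}$-set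 of $G[\Phi]$. (iv) If $\mu=\gamma$ and $\gamma(F_i)\ge 2$ for all $i$, then a $\gamma$-set $U$ as in (iii) is a $\nu$-set of $G[\Phi]$ for every $\nu\in\{\gamma_r,\gamma_t,\gamma_{tr},\gamma^{oc},\gamma_t^{oc}\}$.
   Context: All graphs are finite, simple and undirected; $[n]=\{1,\dots,n\}$. The generalized lexicographic product $G[\Phi]$ is the graph with vertex set $\bigcup_{i=1}^n V(F_i)$ in which each $F_i$ is an induced subgraph, and for $x\in V(F_i)$, $y\in V(F_j)$ with $i\neq j$, $xy$ is an edge iff $ij\in E(G)$. For a graph $H$ and $S\subseteq V(H)$: $S$ is dominating if every vertex outside $S$ has a neighbor in $S$; total dominating if every vertex of $H$ has a neighbor in $S$; a dominating set $S$ is restrained if every vertex outside $S$ has a neighbor outside $S$, and outer-connected if the subgraph induced by $V(H)\setminus S$ is connected. $\gamma,\gamma_t,\gamma_r,\gamma_{tr},\gamma^{oc},\gamma_t^{oc}$ denote the minimum cardinalities of, respectively, dominating, total dominating, restrained dominating, total restrained dominating (total and restrained), outer-connected dominating, and total outer-connected dominating (total and outer-connected) sets. For a parameter $\nu$ among these, a $\nu$-set is a set of the corresponding type of cardinality $\nu(H)$. -}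

module Defs where

open import Data.Nat using (ℕ; zero; suc; _≤_)
open import Data.Bool using (Bool; true; false; _∧_; _∨_; not; if_then_else_)
open import Data.Fin using (Fin)
import Data.Fin as Fin
open import Data.List using (List; []; _∷_; allFin; concatMap; map; foldr)
open import Data.Product using (Σ; ∃; _×_; _,_; proj₁; proj₂)
open import Data.Unit using (⊤)
open import Relation.Nullary using (¬_; yes; no; does)
open import Relation.Binary.PropositionalEquality using (_≡_; refl)
import Data.Nat as ℕ

record Graph (n : ℕ) : Set where
  field
    adj    : Fin n → Fin n → Bool
    sym    : ∀ x y → adj x y ≡ adj y x
    irrefl : ∀ x → adj x x ≡ false

-- A finite graph on an arbitrary vertex type, given with an explicit
-- duplicate-free enumeration of its vertices (used for cardinalities).

record FGraph : Set₁ where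
  field
    V     : Set
    verts : List V
    adj   : V → V → Bool

open FGraph public

toFG : ∀ {m} → Graph m → FGraph
toFG {m} H = record { V = Fin m ; verts = allFin m ; adj = Graph.adj H }

Subset : FGraph → Set
Subset H = V H → Bool

count : {A : Set} → (A → Bool) → List A → ℕ
count P []       = 0
count P (x ∷ xs) = if P x then suc (count P xs) else count P xs

card : (H : FGraph) → Subset H → ℕ
card H S = count S (verts H)

data Walk (H : FGraph) (P : V H → Set) : V H → V H → Set where
  here : ∀ {x} → P x → Walk H P x x
  step : ∀ {x y z} → P x → adj H x y ≡ true → Walk H P y z → Walk H P x z

Connected : FGraph → Set
Connected H = ∀ x y → Walk H (λ _ → ⊤) x y

Dominating : (H : FGraph) → Subset H → Set
Dominating H S = ∀ v → S v ≡ false → ∃ λ u → S u ≡ true × adj H v u ≡ true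

TotalDominating : (H : FGraph) → Subset H → Set
TotalDominating H S = ∀ v → ∃ λ u → S u ≡ true × adj H v u ≡ true

RestrainedCond : (H : FGraph) → Subset H → Set
RestrainedCond H S = ∀ v → S v ≡ false → ∃ λ u → S u ≡ false × adj H v u ≡ true

OuterConnCond : (H : FGraph) → Subset H → Set
OuterConnCond H S = ∀ x y → S x ≡ false → S y ≡ false → Walk H (λ v → S v ≡ false) x y

data Param : Set where
  γ γt γr γtr γoc γtoc : Param

IsType : Param → (H : FGraph) → Subset H → Set
IsType γ    H S = Dominating H S
IsType γt   H S = TotalDominating H S
IsType γr   H S = Dominating H S × RestrainedCond H S
IsType γtr  H S = TotalDominating H S × RestrainedCond H S
IsType γoc  H S = Dominating H S × OuterConnCond H S
IsType γtoc H S = TotalDominating H S × OuterConnCond H S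

IsSet : Param → (H : FGraph) → Subset H → Set
IsSet ν H S = IsType ν H S × (∀ T → IsType ν H T → card H S ≤ card H T)

-- Generalized lexicographic product G[Φ], Φ = (F_1,…,F_n).
-- Vertex (i , a) is the vertex a of F_i; the F_i are disjoint by construction.

module _ {n : ℕ} (G : Graph n) {m : Fin n → ℕ} (F : (i : Fin n) → Graph (m i)) where

  LexV : Set
  LexV = Σ (Fin n) (λ i → Fin (m i))

  lexAdj : LexV → LexV → Bool
  lexAdj (i , a) (j , b) with i Fin.≟ j
  ... | yes refl = Graph.adj (F i) a b
  ... | no _     = Graph.adj G i j

  Lex : FGraph
  Lex = record
    { V     = LexV
    ; verts = concatMap (λ i → map (λ a → (i , a)) (allFin (m i))) (allFin n)
    ; adj   = lexAdj }

  fibre : Subset Lex → (i : Fin n) → Subset (toFG (F i))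
  fibre D i a = D (i , a)

  cardIn : Subset Lex → Fin n → ℕ
  cardIn D i = count (fibre D i) (allFin (m i))

  inR : Subset Lex → Fin n → Bool
  inR D i = does (cardIn D i ℕ.≟ 2)

  Dstar : (D : Subset Lex) (z2 : (i : Fin n) → Fin (m i)) (x : Fin n → LexV) → Subset Lex
  Dstar D z2 x (j , b) =
    (D (j , b) ∧ not (inR D j ∧ does (b Fin.≟ z2 j)))
    ∨ foldr (λ i acc → (inR D i ∧ (does (proj₁ (x i) Fin.≟ j) ∧ eqSnd (x i))) ∨ acc) false (allFin n)
    where
      eqSnd : LexV → Bool
      eqSnd (k , c) with k Fin.≟ j
      ... | yes refl = does (c Fin.≟ b)
      ... | no _     = false

  DistAtLeast3 : LexV → LexV → Set
  DistAtLeast3 x y = ¬ (x ≡ y) × lexAdj x y ≡ false × (∀ w → lexAdj x w ≡ true → lexAdj w y ≡ false)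

module Submission where

-- Everything is an exchange argument for a minimum (total) dominating set D of G[Φ], resting on
-- one observation: a vertex outside F_i adjacent to one vertex of F_i is adjacent to all of them.
-- So three vertices of D in one fibre could be traded for one of them plus a vertex in a
-- neighbouring fibre. If D meets F_s in two vertices, one of them could be dropped were F_s
-- adjacent to D outside F_s; hence F_s is dominated from inside, D ∩ F_s is a minimum dominating
-- set of F_s, and two such fibres cannot share a neighbour k (both could be shrunk at the cost of
-- one vertex in F_k). Replacing z_{i2} by x_i therefore keeps domination, and as the x_i lie in
-- distinct D-free fibres, a fibrewise count gives |D*| ≤ |D| with at most one vertex per fibre.
-- Such a set leaves a free vertex in every fibre, which makes it restrained and, G being
-- connected, outer-connected. If moreover γ(F_i) ≥ 2, its vertex in F_i does not dominate F_i,
-- so some vertex of F_i, and with it all of F_i, has a neighbour in the set outside F_i.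

open import Defs
open import Data.Bool using (Bool; true; false; _∧_; _∨_; not; if_then_else_)
import Data.Bool
open import Data.Bool.Properties
  using (⇔→≡; ¬-not; not-¬; not-injective; ∧-conicalˡ; ∧-conicalʳ; ∨-conicalˡ; ∨-conicalʳ;
         ∨-zeroʳ; ∧-zeroʳ; ∧-identityʳ; ∨-identityʳ)
open import Data.Empty using (⊥; ⊥-elim)
open import Data.Fin using (Fin; zero; suc; fromℕ<)
import Data.Fin as Fin
import Data.Fin.Properties as FinP
open import Data.List using (List; []; _∷_; _++_; map; concatMap; tabulate; allFin; length; filter; foldr)
import Data.List.Extrema.Nat as Extrema
open import Data.List.Membership.Propositional using (_∈_; lose)
open import Data.List.Membership.Propositional.Properties
  using (∈-map⁺; ∈-++⁺ˡ; ∈-++⁺ʳ; ∈-filter⁺; ∈-allFin; ∈-concat⁺′)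
open import Data.List.Properties using (length-tabulate)
open import Data.List.Relation.Unary.All as All using (All; []; _∷_)
open import Data.List.Relation.Unary.All.Properties using (all-filter)
open import Data.List.Relation.Unary.AllPairs using (_∷_)
import Data.List.Relation.Unary.Any as Any
open import Data.List.Relation.Unary.Any using (here; there)
open import Data.List.Relation.Unary.Unique.Propositional using (Unique)
open import Data.List.Relation.Unary.Unique.Propositional.Properties using (allFin⁺)
open import Data.Nat using (ℕ; zero; suc; _+_; _≤_; _<_; z≤n; s≤s; _≤?_)
import Data.Nat as ℕ
open import Data.Nat.Properties
open import Algebra.Properties.CommutativeMonoid.Sum +-0-commutativeMonoid
  using (sum; sum-syntax; sum-cong-≗; ∑-comm; ∑-distrib-+)
open import Algebra.Properties.CommutativeSemigroup +-commutativeSemigroup using (interchange)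
open import Data.Product using (Σ; ∃; _×_; _,_; proj₁; proj₂)
open import Data.Product.Properties using (≡-dec)
open import Data.Sum using (_⊎_; inj₁; inj₂; map₂)
open import Data.Unit using (⊤)
open import Function using (_∘_)
open import Function.Bundles using (mk⇔)
open import Relation.Binary.Definitions using (DecidableEquality)
open import Relation.Binary.PropositionalEquality
open import Relation.Nullary using (¬_; Dec; yes; no; does)
open import Relation.Nullary.Decidable using (dec-true; dec-false; map′; _×-dec_; _⊎-dec_; _→-dec_)
open import Relation.Unary using (Decidable)

private
  variable
    A B : Set

does-true : ∀ {P : Set} (P? : Dec P) → does P? ≡ true → P
does-true (yes p) _ = p

∨-true⇒ : ∀ a {b} → a ∨ b ≡ true → a ≡ true ⊎ b ≡ true
∨-true⇒ true  _  = inj₁ refl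
∨-true⇒ false b≡ = inj₂ b≡

foldr-∨-true⇒ : ∀ {f : A → Bool} xs → foldr (λ x acc → f x ∨ acc) false xs ≡ true →
  ∃ λ x → f x ≡ true
foldr-∨-true⇒ {f = f} (x ∷ xs) any with ∨-true⇒ (f x) any
... | inj₁ fx   = x , fx
... | inj₂ rest = foldr-∨-true⇒ xs rest

∨-true⇐ˡ : ∀ {a b} → a ≡ true → a ∨ b ≡ true
∨-true⇐ˡ refl = refl

foldr-∨-false⇒ : ∀ {f : A → Bool} {x} xs → foldr (λ x acc → f x ∨ acc) false xs ≡ false →
  x ∈ xs → f x ≡ false
foldr-∨-false⇒ {f = f} (y ∷ ys) none (here refl) = ∨-conicalˡ (f y) _ none
foldr-∨-false⇒ {f = f} (y ∷ ys) none (there x∈) = foldr-∨-false⇒ ys (∨-conicalʳ (f y) _ none) x∈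

indicator : Bool → ℕ
indicator true  = 1
indicator false = 0

sum-mono-≤ : ∀ {k} {f g : Fin k → ℕ} → (∀ i → f i ≤ g i) → sum f ≤ sum g
sum-mono-≤ {zero}  f≤g = z≤n
sum-mono-≤ {suc k} f≤g = +-mono-≤ (f≤g zero) (sum-mono-≤ (f≤g ∘ suc))

count-∷ : ∀ (P : A → Bool) x xs → count P (x ∷ xs) ≡ indicator (P x) + count P xs
count-∷ P x xs with P x
... | true  = refl
... | false = refl

count-++ : ∀ (P : A → Bool) xs ys → count P (xs ++ ys) ≡ count P xs + count P ys
count-++ P []       ys = refl
count-++ P (x ∷ xs) ys = begin
  count P (x ∷ xs ++ ys)                        ≡⟨ count-∷ P x (xs ++ ys) ⟩
  indicator (P x) + count P (xs ++ ys)          ≡⟨ cong (indicator (P x) +_) (count-++ P xs ys) ⟩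
  indicator (P x) + (count P xs + count P ys)   ≡⟨ +-assoc (indicator (P x)) _ _ ⟨
  (indicator (P x) + count P xs) + count P ys   ≡⟨ cong (_+ count P ys) (count-∷ P x xs) ⟨
  count P (x ∷ xs) + count P ys                 ∎
  where open ≡-Reasoning

count-cong : ∀ {P Q : A → Bool} → (∀ x → P x ≡ Q x) → ∀ xs → count P xs ≡ count Q xs
count-cong P≗Q []       = refl
count-cong {P = P} {Q = Q} P≗Q (x ∷ xs) = begin
  count P (x ∷ xs)                  ≡⟨ count-∷ P x xs ⟩
  indicator (P x) + count P xs      ≡⟨ cong₂ _+_ (cong indicator (P≗Q x)) (count-cong P≗Q xs) ⟩
  indicator (Q x) + count Q xs      ≡⟨ count-∷ Q x xs ⟨
  count Q (x ∷ xs)                  ∎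
  where open ≡-Reasoning

count-all-false : ∀ {P : A → Bool} → (∀ x → P x ≡ false) → ∀ xs → count P xs ≡ 0
count-all-false P≗false []       = refl
count-all-false P≗false (x ∷ xs) rewrite P≗false x = count-all-false P≗false xs

count-∧+∨ : ∀ {A : Set} (P Q : A → Bool) xs →
  count P xs + count Q xs ≡ count (λ x → P x ∧ Q x) xs + count (λ x → P x ∨ Q x) xs
count-∧+∨ {A} P Q []       = refl
count-∧+∨ {A} P Q (x ∷ xs) = begin
  count P (x ∷ xs) + count Q (x ∷ xs)
    ≡⟨ cong₂ _+_ (count-∷ P x xs) (count-∷ Q x xs) ⟩
  (indicator (P x) + count P xs) + (indicator (Q x) + count Q xs)
    ≡⟨ interchange (indicator (P x)) _ _ _ ⟩
  (indicator (P x) + indicator (Q x)) + (count P xs + count Q xs)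
    ≡⟨ cong₂ _+_ (indicator-∧+∨ (P x) (Q x)) (count-∧+∨ P Q xs) ⟩
  (indicator (P x ∧ Q x) + indicator (P x ∨ Q x)) + (count P∧Q xs + count P∨Q xs)
    ≡⟨ interchange (indicator (P x ∧ Q x)) _ _ _ ⟩
  (indicator (P x ∧ Q x) + count P∧Q xs) + (indicator (P x ∨ Q x) + count P∨Q xs)
    ≡⟨ cong₂ _+_ (count-∷ P∧Q x xs) (count-∷ P∨Q x xs) ⟨
  count P∧Q (x ∷ xs) + count P∨Q (x ∷ xs) ∎
  where
  open ≡-Reasoning
  P∧Q P∨Q : A → Bool
  P∧Q y = P y ∧ Q y
  P∨Q y = P y ∨ Q y
  indicator-∧+∨ : ∀ a b → indicator a + indicator b ≡ indicator (a ∧ b) + indicator (a ∨ b)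
  indicator-∧+∨ true  true  = refl
  indicator-∧+∨ true  false = refl
  indicator-∧+∨ false true  = refl
  indicator-∧+∨ false false = refl

count≥1⇒∃ : ∀ {P : A → Bool} xs → 1 ≤ count P xs → ∃ λ x → P x ≡ true
count≥1⇒∃ {P = P} (x ∷ xs) 1≤c with P x in Px
... | true  = x , Px
... | false = count≥1⇒∃ xs 1≤c

count<length⇒∃ : ∀ {P : A → Bool} xs → count P xs < length xs → ∃ λ x → P x ≡ false
count<length⇒∃ {P = P} (x ∷ xs) c< with P x in Px
... | false = x , Px
... | true  = count<length⇒∃ xs (≤-pred c<)

count-map : ∀ (P : B → Bool) (f : A → B) xs → count P (map f xs) ≡ count (P ∘ f) xs
count-map P f []       = refl
count-map P f (x ∷ xs) with P (f x)
... | true  = cong suc (count-map P f xs)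
... | false = count-map P f xs

count-tabulate : ∀ (P : A → Bool) {k} (g : Fin k → A) →
  count P (tabulate g) ≡ ∑[ i < k ] indicator (P (g i))
count-tabulate P {zero}  g = refl
count-tabulate P {suc k} g = trans (count-∷ P (g zero) (tabulate (g ∘ suc)))
  (cong (indicator (P (g zero)) +_) (count-tabulate P (g ∘ suc)))

count-concatMap-tabulate : ∀ (P : B → Bool) (f : A → List B) {k} (g : Fin k → A) →
  count P (concatMap f (tabulate g)) ≡ ∑[ i < k ] count P (f (g i))
count-concatMap-tabulate P f {zero}  g = refl
count-concatMap-tabulate P f {suc k} g =
  trans (count-++ P (f (g zero)) _)
        (cong (count P (f (g zero)) +_) (count-concatMap-tabulate P f (g ∘ suc)))

count-allFin : ∀ {k} (P : Fin k → Bool) → count P (allFin k) ≡ ∑[ i < k ] indicator (P i)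
count-allFin P = count-tabulate P (λ i → i)

module WithDecidableEquality {A : Set} (_≟_ : DecidableEquality A) where

  _≡ᵇ_ : A → A → Bool
  a ≡ᵇ b = does (a ≟ b)

  ≡ᵇ-refl : ∀ a → (a ≡ᵇ a) ≡ true
  ≡ᵇ-refl a = dec-true (a ≟ a) refl

  ≢⇒≡ᵇ-false : ∀ {a b} → a ≢ b → (a ≡ᵇ b) ≡ false
  ≢⇒≡ᵇ-false {a} {b} = dec-false (a ≟ b)

  ≡ᵇ-true⇒≡ : ∀ {a b} → (a ≡ᵇ b) ≡ true → a ≡ b
  ≡ᵇ-true⇒≡ {a} {b} = does-true (a ≟ b)

  ≡ᵇ-sym : ∀ a b → (a ≡ᵇ b) ≡ (b ≡ᵇ a)
  ≡ᵇ-sym a b with a ≟ b | b ≟ a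
  ... | yes _   | yes _   = refl
  ... | no  _   | no  _   = refl
  ... | yes a≡b | no  b≢a = ⊥-elim (b≢a (sym a≡b))
  ... | no  a≢b | yes b≡a = ⊥-elim (a≢b (sym b≡a))

  infixl 6 _─_ _＋_

  _─_ : (A → Bool) → A → (A → Bool)
  (S ─ w) a = S a ∧ not (a ≡ᵇ w)

  _＋_ : (A → Bool) → A → (A → Bool)
  (S ＋ w) a = S a ∨ (a ≡ᵇ w)

  ─-keeps : ∀ {S w a} → S a ≡ true → a ≢ w → (S ─ w) a ≡ true
  ─-keeps Sa a≢w = cong₂ _∧_ Sa (cong not (≢⇒≡ᵇ-false a≢w))

  ─-⊆ : ∀ {S w a} → (S ─ w) a ≡ true → S a ≡ true
  ─-⊆ {S} {a = a} = ∧-conicalˡ (S a) _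

  ─-excludes : ∀ {S w a} → (S ─ w) a ≡ true → a ≢ w
  ─-excludes {S} {w} S─wa refl =
    not-¬ S─wa (trans (cong (λ b → S w ∧ not b) (≡ᵇ-refl w)) (∧-zeroʳ (S w)))

  ─-drops : ∀ {S w a} → (S ─ w) a ≡ false → S a ≡ false ⊎ a ≡ w
  ─-drops {S} {w} {a} S─wa with S a | a ≟ w
  ... | false | _       = inj₁ refl
  ... | true  | yes a≡w = inj₂ a≡w

  ＋-new : ∀ {S w} → (S ＋ w) w ≡ true
  ＋-new {S} {w} = trans (cong (S w ∨_) (≡ᵇ-refl w)) (∨-zeroʳ (S w))

  ＋-keeps : ∀ {S w a} → S a ≡ true → (S ＋ w) a ≡ true
  ＋-keeps Sa = cong (_∨ _) Sa

  ＋-false⇒false : ∀ {S w a} → (S ＋ w) a ≡ false → S a ≡ false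
  ＋-false⇒false {S} {a = a} = ∨-conicalˡ (S a) _

  Enumerates : List A → Set
  Enumerates xs = ∀ a → count (_≡ᵇ a) xs ≡ 1

  unique⇒enumerates : ∀ {xs} → Unique xs → (∀ a → a ∈ xs) → Enumerates xs
  unique⇒enumerates u complete a = go u (complete a)
    where
    absent : ∀ {ys} → All (a ≢_) ys → count (_≡ᵇ a) ys ≡ 0
    absent []           = refl
    absent (a≢y ∷ a≢ys) rewrite ≢⇒≡ᵇ-false (a≢y ∘ sym) = absent a≢ys
    go : ∀ {ys} → Unique ys → a ∈ ys → count (_≡ᵇ a) ys ≡ 1
    go (a≢ys ∷ _) (here refl) rewrite ≡ᵇ-refl a = cong suc (absent a≢ys)
    go (y≢ys ∷ u) (there a∈) rewrite ≢⇒≡ᵇ-false (All.lookup y≢ys a∈) = go u a∈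

  module Counting {xs : List A} (enum : Enumerates xs) where

    count-─ : ∀ {S w} → S w ≡ true → suc (count (S ─ w) xs) ≡ count S xs
    count-─ {S} {w} Sw = begin
      suc (count (S ─ w) xs)                  ≡⟨ +-comm 1 _ ⟩
      count (S ─ w) xs + 1                    ≡⟨ cong (count (S ─ w) xs +_) (enum w) ⟨
      count (S ─ w) xs + count (_≡ᵇ w) xs     ≡⟨ count-∧+∨ (S ─ w) (_≡ᵇ w) xs ⟩
      count (λ a → (S ─ w) a ∧ (a ≡ᵇ w)) xs + count (λ a → (S ─ w) a ∨ (a ≡ᵇ w)) xs
        ≡⟨ cong₂ _+_ (count-all-false disjoint xs) (count-cong restore xs) ⟩
      count S xs                              ∎
      where
      open ≡-Reasoning
      disjoint : ∀ a → ((S ─ w) a ∧ (a ≡ᵇ w)) ≡ false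
      disjoint a with a ≟ w
      ... | yes refl = trans (∧-identityʳ _) (∧-zeroʳ (S a))
      ... | no  _    = ∧-zeroʳ _
      restore : ∀ a → ((S ─ w) a ∨ (a ≡ᵇ w)) ≡ S a
      restore a with a ≟ w
      ... | yes refl = trans (∨-zeroʳ _) (sym Sw)
      ... | no  _    = trans (∨-identityʳ _) (∧-identityʳ (S a))

    count-＋ : ∀ {S w} → count (S ＋ w) xs ≤ suc (count S xs)
    count-＋ {S} {w} = begin
      count (S ＋ w) xs                                           ≤⟨ m≤n+m _ _ ⟩
      count (λ a → S a ∧ (a ≡ᵇ w)) xs + count (S ＋ w) xs         ≡⟨ count-∧+∨ S (_≡ᵇ w) xs ⟨
      count S xs + count (_≡ᵇ w) xs                               ≡⟨ cong (count S xs +_) (enum w) ⟩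
      count S xs + 1                                              ≡⟨ +-comm _ 1 ⟩
      suc (count S xs)                                            ∎
      where open ≤-Reasoning

    member⇒count≥1 : ∀ {S a} → S a ≡ true → 1 ≤ count S xs
    member⇒count≥1 Sa = subst (1 ≤_) (count-─ Sa) (s≤s z≤n)

    count≥2⇒other : ∀ {S w} → 2 ≤ count S xs → S w ≡ true → ∃ λ a → a ≢ w × S a ≡ true
    count≥2⇒other {S} {w} 2≤ Sw =
      let a , S─wa = count≥1⇒∃ xs (≤-pred (subst (2 ≤_) (sym (count-─ Sw)) 2≤))
      in a , ─-excludes {S} S─wa , ─-⊆ {S} S─wa

    distinct⇒count≥2 : ∀ {S a b} → a ≢ b → S a ≡ true → S b ≡ true → 2 ≤ count S xs
    distinct⇒count≥2 {S} a≢b Sa Sb =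
      subst (2 ≤_) (count-─ Sb) (s≤s (member⇒count≥1 {S ─ _} (─-keeps {S} Sa a≢b)))

    count≥3⇒three : ∀ {S} → 3 ≤ count S xs →
      ∃ λ a → ∃ λ b → ∃ λ c →
        a ≢ b × a ≢ c × b ≢ c × S a ≡ true × S b ≡ true × S c ≡ true
    count≥3⇒three {S} 3≤ =
      let a , Sa      = count≥1⇒∃ xs (≤-trans (s≤s z≤n) 3≤)
          2≤S─a       = ≤-pred (subst (3 ≤_) (sym (count-─ Sa)) 3≤)
          b , S─ab    = count≥1⇒∃ xs (≤-trans (s≤s z≤n) 2≤S─a)
          c , c≢b , S─ac = count≥2⇒other {S ─ a} 2≤S─a S─ab
      in a , b , c , ─-excludes {S} S─ab ∘ sym , ─-excludes {S} S─ac ∘ sym , c≢b ∘ sym ,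
         Sa , ─-⊆ {S} S─ab , ─-⊆ {S} S─ac

    count≤1⇒unique : ∀ {S a b} → count S xs ≤ 1 → S a ≡ true → S b ≡ true → a ≡ b
    count≤1⇒unique {S} {a} {b} ≤1 Sa Sb with a ≟ b
    ... | yes a≡b = a≡b
    ... | no  a≢b = ⊥-elim (<-irrefl refl (≤-trans (distinct⇒count≥2 {S} a≢b Sa Sb) ≤1))

    pairwise-equal⇒count≤1 : ∀ {S} → (∀ {a b} → S a ≡ true → S b ≡ true → a ≡ b) →
      count S xs ≤ 1
    pairwise-equal⇒count≤1 {S} same with count S xs ≤? 1
    ... | yes ≤1 = ≤1
    ... | no  ≰1 =
      let w , Sw        = count≥1⇒∃ xs (≤-trans (s≤s z≤n) (≰⇒> ≰1))
          a , a≢w , Sa  = count≥2⇒other (≰⇒> ≰1) Sw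
      in ⊥-elim (a≢w (same Sa Sw))

    ──＋-smaller : ∀ {S w₁ w₂ w₃} → S w₁ ≡ true → S w₂ ≡ true → w₂ ≢ w₁ →
      count (S ─ w₁ ─ w₂ ＋ w₃) xs < count S xs
    ──＋-smaller {S} {w₁} {w₂} {w₃} Sw₁ Sw₂ w₂≢w₁ = begin-strict
      count (S ─ w₁ ─ w₂ ＋ w₃) xs         <⟨ s≤s (count-＋ {S ─ w₁ ─ w₂}) ⟩
      suc (suc (count (S ─ w₁ ─ w₂) xs))   ≡⟨ cong suc (count-─ (─-keeps {S} Sw₂ w₂≢w₁)) ⟩
      suc (count (S ─ w₁) xs)              ≡⟨ count-─ Sw₁ ⟩
      count S xs                           ∎
      where open ≤-Reasoning

  ──＋-dropped : ∀ {S w₁ w₂ w₃ u} → S u ≡ true → (S ─ w₁ ─ w₂ ＋ w₃) u ≡ false →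
    u ≡ w₁ ⊎ u ≡ w₂
  ──＋-dropped {S} {w₁} {w₂} {w₃} Su S′u
    with ─-drops {S ─ w₁} (＋-false⇒false {S ─ w₁ ─ w₂} {w₃} S′u)
  ... | inj₂ u≡w₂ = inj₂ u≡w₂
  ... | inj₁ S─w₁u with ─-drops {S} S─w₁u
  ...   | inj₁ Su≡false = ⊥-elim (not-¬ Su Su≡false)
  ...   | inj₂ u≡w₁     = inj₁ u≡w₁

  ──＋-keeps : ∀ {S w₁ w₂ w₃ u} → S u ≡ true → u ≢ w₁ → u ≢ w₂ →
    (S ─ w₁ ─ w₂ ＋ w₃) u ≡ true
  ──＋-keeps {S} {w₁} Su u≢w₁ u≢w₂ =
    ＋-keeps {S ─ w₁ ─ _} (─-keeps {S ─ w₁} (─-keeps {S} Su u≢w₁) u≢w₂)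

  update : A → Bool → (A → Bool) → (A → Bool)
  update y b S a = if a ≡ᵇ y then b else S a

  subsetsOn : List A → List (A → Bool)
  subsetsOn []       = (λ _ → false) ∷ []
  subsetsOn (y ∷ ys) = map (update y true) (subsetsOn ys) ++ map (update y false) (subsetsOn ys)

  subsetsOn-complete : ∀ xs (S : A → Bool) →
    ∃ λ (S′ : A → Bool) → S′ ∈ subsetsOn xs × (∀ a → a ∈ xs → S a ≡ S′ a)
  subsetsOn-complete []       S = (λ _ → false) , here refl , λ _ ()
  subsetsOn-complete (y ∷ ys) S = extend (subsetsOn-complete ys S)
    where
    choose : ∀ b {S′} → S′ ∈ subsetsOn ys → update y b S′ ∈ subsetsOn (y ∷ ys)
    choose true  S′∈ = ∈-++⁺ˡ (∈-map⁺ (update y true) S′∈)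
    choose false S′∈ = ∈-++⁺ʳ _ (∈-map⁺ (update y false) S′∈)
    extend : (∃ λ (S′ : A → Bool) → S′ ∈ subsetsOn ys × (∀ a → a ∈ ys → S a ≡ S′ a)) →
      ∃ λ (S′ : A → Bool) → S′ ∈ subsetsOn (y ∷ ys) × (∀ a → a ∈ y ∷ ys → S a ≡ S′ a)
    extend (S′ , S′∈ , S≗S′) = update y (S y) S′ , choose (S y) S′∈ , agree
      where
      agree : ∀ a → a ∈ y ∷ ys → S a ≡ update y (S y) S′ a
      agree a a∈ with a ≟ y | a∈
      ... | yes refl | _          = refl
      ... | no a≢y   | here a≡y   = ⊥-elim (a≢y a≡y)
      ... | no _     | there a∈ys = S≗S′ a a∈ys

  minimum-exists : ∀ {P : (A → Bool) → Set} (xs : List A) → (∀ a → a ∈ xs) → Decidable P →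
    (∀ {S T} → (∀ a → S a ≡ T a) → P S → P T) → ∀ S₀ → P S₀ →
    ∃ λ (S : A → Bool) → P S × (∀ T → P T → count S xs ≤ count T xs)
  minimum-exists {P} xs complete P? resp S₀ PS₀ = S , PS , minimal
    where
    size : (A → Bool) → ℕ
    size S = count S xs
    candidates : List (A → Bool)
    candidates = filter P? (subsetsOn xs)
    S : A → Bool
    S = Extrema.argmin size S₀ candidates
    PS : P S
    PS = Extrema.argmin-all size PS₀ (all-filter P? (subsetsOn xs))
    minimal : ∀ T → P T → size S ≤ size T
    minimal T PT with subsetsOn-complete xs T
    ... | T′ , T′∈ , T≗T′ =
      let T≗ = λ a → T≗T′ a (complete a) in
      subst (size S ≤_) (sym (count-cong T≗ xs))
        (All.lookup (Extrema.f[argmin]≤f[xs] S₀ candidates) (∈-filter⁺ P? T′∈ (resp T≗ PT)))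

-- One flag covers γ and γt: with total = false only the vertices outside S need a neighbour in S.
Needs : Bool → {H : FGraph} → Subset H → V H → Set
Needs total S v = total ≡ true ⊎ S v ≡ false

Dom : Bool → (H : FGraph) → Subset H → Set
Dom total H S = ∀ v → Needs total {H} S v → ∃ λ u → S u ≡ true × adj H v u ≡ true

MinDom : Bool → (H : FGraph) → Subset H → Set
MinDom total H S = Dom total H S × (∀ T → Dom total H T → card H S ≤ card H T)

paramOf : Bool → Param
paramOf false = γ
paramOf true  = γt

module _ {H : FGraph} where

  IsType⇒Dom : ∀ total {S} → IsType (paramOf total) H S → Dom total H S
  IsType⇒Dom false dom v (inj₂ Sv) = dom v Sv
  IsType⇒Dom true  dom v _         = dom v

  Dom⇒IsType : ∀ total {S} → Dom total H S → IsType (paramOf total) H S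
  Dom⇒IsType false dom v Sv = dom v (inj₂ Sv)
  Dom⇒IsType true  dom v    = dom v (inj₁ refl)

  IsSet⇒MinDom : ∀ total {S} → IsSet (paramOf total) H S → MinDom total H S
  IsSet⇒MinDom total (dom , min) = IsType⇒Dom total dom , λ T → min T ∘ Dom⇒IsType total

  MinDom⇒IsSet : ∀ total {S} → MinDom total H S → IsSet (paramOf total) H S
  MinDom⇒IsSet total (dom , min) = Dom⇒IsType total dom , λ T → min T ∘ IsType⇒Dom total

  IsSet-inherit : ∀ μ ν {U} → (∀ T → IsType ν H T → IsType μ H T) →
    IsType ν H U → IsSet μ H U → IsSet ν H U
  IsSet-inherit _ _ ν⇒μ typeU (_ , min) = typeU , λ T → min T ∘ ν⇒μ T

  Dom-cong : ∀ {total S T} → (∀ v → S v ≡ T v) → Dom total H S → Dom total H T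
  Dom-cong S≗T dom v needs
    with u , Su , vu ← dom v (map₂ (trans (S≗T v)) needs)
    = u , trans (sym (S≗T u)) Su , vu

  Dom-dec : (∀ v → v ∈ verts H) → ∀ total S → Dec (Dom total H S)
  Dom-dec complete total S =
    map′ (λ all v → All.lookup all (complete v)) (λ dom → All.tabulate (λ {v} _ → dom v))
      (All.all? (λ v → needs? v →-dec neighbour? v) (verts H))
    where
    needs? : ∀ v → Dec (Needs total {H} S v)
    needs? v = (total Data.Bool.≟ true) ⊎-dec (S v Data.Bool.≟ false)
    neighbour? : ∀ v → Dec (∃ λ u → S u ≡ true × adj H v u ≡ true)
    neighbour? v = map′ Any.satisfied (λ (u , p) → lose (complete u) p)
      (Any.any? (λ u → (S u Data.Bool.≟ true) ×-dec (adj H v u Data.Bool.≟ true)) (verts H))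

  Dom-exchange : ∀ {total D D′} → Dom total H D →
    (∀ v → D v ≡ true → D′ v ≡ false → ∃ λ u → D′ u ≡ true × adj H v u ≡ true) →
    (∀ v u → Needs total {H} D′ v → D u ≡ true → D′ u ≡ false → adj H v u ≡ true →
       ∃ λ u′ → D′ u′ ≡ true × adj H v u′ ≡ true) →
    Dom total H D′
  Dom-exchange {total} {D} {D′} dom lost near-lost v needs′ = by-cases (D v) refl needs′
    where
    via-D : Needs total {H} D v → ∃ λ u → D′ u ≡ true × adj H v u ≡ true
    via-D needs with u , Du , vu ← dom v needs with D′ u in D′u
    ... | true  = u , D′u , vu
    ... | false = near-lost v u needs′ Du D′u vu
    by-cases : ∀ b → D v ≡ b → Needs total {H} D′ v → ∃ λ u → D′ u ≡ true × adj H v u ≡ true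
    by-cases true  Dv (inj₂ D′v)  = lost v Dv D′v
    by-cases true  _  (inj₁ tot)  = via-D (inj₁ tot)
    by-cases false Dv _           = via-D (inj₂ Dv)

  Dom-nonempty : ∀ {total T} → Dom total H T → V H → ∃ λ u → T u ≡ true
  Dom-nonempty {T = T} dom v with T v in Tv
  ... | true  = v , Tv
  ... | false = let u , Tu , _ = dom v (inj₂ Tv) in u , Tu

  MinDom-no-smaller : ∀ {total D D′} → MinDom total H D → Dom total H D′ → card H D′ < card H D → ⊥
  MinDom-no-smaller (_ , min) dom′ smaller = <-irrefl refl (≤-trans smaller (min _ dom′))

  MinDom-exists : DecidableEquality (V H) → (∀ v → v ∈ verts H) →
    ∀ {total S₀} → Dom total H S₀ → ∃ (MinDom total H)
  MinDom-exists _≟_ complete {total} {S₀} dom₀ =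
    WithDecidableEquality.minimum-exists _≟_ (verts H) complete (Dom-dec complete total) Dom-cong S₀ dom₀

module FinEq {k : ℕ} = WithDecidableEquality (Fin._≟_ {k})

allFin-enumerates : ∀ k → FinEq.Enumerates (allFin k)
allFin-enumerates k = FinEq.unique⇒enumerates (allFin⁺ k) ∈-allFin

module AllFinCount (k : ℕ) = FinEq.Counting {k} {allFin k} (allFin-enumerates k)

module LexProduct {n : ℕ} (G : Graph n) {m : Fin n → ℕ} (F : (i : Fin n) → Graph (m i)) where

  L : FGraph
  L = Lex G F

  lexAdj-within : ∀ i a b → lexAdj G F (i , a) (i , b) ≡ Graph.adj (F i) a b
  lexAdj-within i a b with i Fin.≟ i
  ... | yes refl = refl
  ... | no  i≢i  = ⊥-elim (i≢i refl)

  lexAdj-across : ∀ {i j} a b → i ≢ j → lexAdj G F (i , a) (j , b) ≡ Graph.adj G i j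
  lexAdj-across {i} {j} a b i≢j with i Fin.≟ j
  ... | yes i≡j = ⊥-elim (i≢j i≡j)
  ... | no  _   = refl

  G-adj⇒≢ : ∀ {i j} → Graph.adj G i j ≡ true → i ≢ j
  G-adj⇒≢ {i} ij refl = not-¬ ij (Graph.irrefl G i)

  G-adj-sym : ∀ {i j} → Graph.adj G i j ≡ true → Graph.adj G j i ≡ true
  G-adj-sym {i} {j} = trans (Graph.sym G j i)

  lexAdj⇒G-adj : ∀ {i j a b} → lexAdj G F (i , a) (j , b) ≡ true → i ≢ j → Graph.adj G i j ≡ true
  lexAdj⇒G-adj {a = a} {b} ab i≢j = trans (sym (lexAdj-across a b i≢j)) ab

  G-adj⇒lexAdj : ∀ {i j} → Graph.adj G i j ≡ true → ∀ a b → lexAdj G F (i , a) (j , b) ≡ true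
  G-adj⇒lexAdj ij a b = trans (lexAdj-across a b (G-adj⇒≢ ij)) ij

  _≟ᵥ_ : DecidableEquality (LexV G F)
  _≟ᵥ_ = ≡-dec Fin._≟_ Fin._≟_

  open WithDecidableEquality _≟ᵥ_ public

  pair-≢ : ∀ {i} {a b : Fin (m i)} → a ≢ b → _≢_ {A = LexV G F} (i , a) (i , b)
  pair-≢ a≢b refl = a≢b refl

  pair-injective : ∀ {i} {a b : Fin (m i)} → _≡_ {A = LexV G F} (i , a) (i , b) → a ≡ b
  pair-injective refl = refl

  fst-≢ : ∀ {i j} {a : Fin (m i)} {b : Fin (m j)} → i ≢ j → _≢_ {A = LexV G F} (i , a) (j , b)
  fst-≢ i≢j refl = i≢j refl

  verts-complete : ∀ v → v ∈ verts L
  verts-complete (i , a) = ∈-concat⁺′ (∈-map⁺ (i ,_) (∈-allFin a)) (∈-map⁺ _ (∈-allFin i))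

  card≡∑cardIn : ∀ S → card L S ≡ ∑[ i < n ] cardIn G F S i
  card≡∑cardIn S =
    trans (count-concatMap-tabulate S (λ i → map (i ,_) (allFin (m i))) {n} (λ i → i))
          (sum-cong-≗ (λ i → count-map S (i ,_) (allFin (m i))))

  verts-enumerates : Enumerates (verts L)
  verts-enumerates (s , b) = begin
    count (_≡ᵇ (s , b)) (verts L)          ≡⟨ card≡∑cardIn (_≡ᵇ (s , b)) ⟩
    ∑[ i < n ] cardIn G F (_≡ᵇ (s , b)) i  ≡⟨ sum-cong-≗ (λ i → fibre-count i (i Fin.≟ s)) ⟩
    ∑[ i < n ] indicator (i FinEq.≡ᵇ s)    ≡⟨ count-allFin (FinEq._≡ᵇ s) ⟨
    count (FinEq._≡ᵇ s) (allFin n)         ≡⟨ allFin-enumerates n s ⟩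
    1                                      ∎
    where
    open ≡-Reasoning
    same-fibre : ∀ a → ((s , a) ≡ᵇ (s , b)) ≡ (a FinEq.≡ᵇ b)
    same-fibre a with a Fin.≟ b
    ... | yes refl = ≡ᵇ-refl (s , a)
    ... | no  a≢b  = ≢⇒≡ᵇ-false (pair-≢ a≢b)
    fibre-count : ∀ i → Dec (i ≡ s) → cardIn G F (_≡ᵇ (s , b)) i ≡ indicator (i FinEq.≡ᵇ s)
    fibre-count i (yes refl) = begin
      count (λ a → (s , a) ≡ᵇ (s , b)) (allFin (m s))   ≡⟨ count-cong same-fibre (allFin (m s)) ⟩
      count (FinEq._≡ᵇ b) (allFin (m s))                ≡⟨ allFin-enumerates (m s) b ⟩
      1                                                 ≡⟨ cong indicator (FinEq.≡ᵇ-refl s) ⟨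
      indicator (s FinEq.≡ᵇ s)                          ∎
    fibre-count i (no i≢s) = begin
      count (λ a → (i , a) ≡ᵇ (s , b)) (allFin (m i))
        ≡⟨ count-all-false (λ _ → ≢⇒≡ᵇ-false (fst-≢ i≢s)) (allFin (m i)) ⟩
      0                                                 ≡⟨ cong indicator (FinEq.≢⇒≡ᵇ-false i≢s) ⟨
      indicator (i FinEq.≡ᵇ s)                          ∎

  open Counting {verts L} verts-enumerates public using (count-─; ──＋-smaller)

  cardIn≡2⇒pair : ∀ S i → cardIn G F S i ≡ 2 →
    ∃ λ a → ∃ λ b → a ≢ b × S (i , a) ≡ true × S (i , b) ≡ true
  cardIn≡2⇒pair S i c≡2 =
    let b , Sb        = count≥1⇒∃ (allFin (m i)) (subst (1 ≤_) (sym c≡2) (s≤s z≤n))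
        a , a≢b , Sa  = AllFinCount.count≥2⇒other (m i) (≤-reflexive (sym c≡2)) Sb
    in a , b , a≢b , Sa , Sb

  FibreRepaired : Bool → Subset L → Fin n → Set
  FibreRepaired total D′ i =
    (∃ λ a → D′ (i , a) ≡ true) ×
    (∀ e → Needs total {L} D′ (i , e) → ∃ λ u → D′ u ≡ true × lexAdj G F (i , e) u ≡ true)

  -- Only fibres that lost a vertex need checking, since a vertex adjacent to one vertex of F_i
  -- from outside is adjacent to all of F_i.
  Dom-fibrewise : ∀ {total D D′} → Dom total L D →
    (∀ {i a} → D (i , a) ≡ true → D′ (i , a) ≡ false → FibreRepaired total D′ i) →
    Dom total L D′
  Dom-fibrewise {total} {D} {D′} dom repaired = Dom-exchange {H = L} dom lost near-lost
    where
    lost : ∀ v → D v ≡ true → D′ v ≡ false → ∃ λ u → D′ u ≡ true × lexAdj G F v u ≡ true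
    lost (i , a) Dv D′v = proj₂ (repaired Dv D′v) a (inj₂ D′v)
    near-lost : ∀ v u → Needs total {L} D′ v → D u ≡ true → D′ u ≡ false →
      lexAdj G F v u ≡ true → ∃ λ u′ → D′ u′ ≡ true × lexAdj G F v u′ ≡ true
    near-lost (k , e) (l , f) needs Du D′u v~u with k Fin.≟ l
    ... | yes refl = proj₂ (repaired Du D′u) e needs
    ... | no  k≢l  =
      let a , D′la = proj₁ (repaired Du D′u)
      in (l , a) , D′la , G-adj⇒lexAdj v~u e a

module MinimumDominatingSet {n : ℕ} (G : Graph n) {m : Fin n → ℕ} (F : (i : Fin n) → Graph (m i))
  (neighbour : ∀ i → ∃ λ j → Graph.adj G i j ≡ true) (point : ∀ i → Fin (m i))
  {total : Bool} {D : Subset (Lex G F)} (minD : MinDom total (Lex G F) D) where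

  open LexProduct G F

  dom : Dom total L D
  dom = proj₁ minD

  no-Dom-─ : ∀ {w} → D w ≡ true → ¬ Dom total L (D ─ w)
  no-Dom-─ Dw dom′ = MinDom-no-smaller {H = L} minD dom′ (≤-reflexive (count-─ Dw))

  no-Dom-──＋ : ∀ {w₁ w₂ w₃} → D w₁ ≡ true → D w₂ ≡ true → w₂ ≢ w₁ →
    ¬ Dom total L (D ─ w₁ ─ w₂ ＋ w₃)
  no-Dom-──＋ Dw₁ Dw₂ w₂≢w₁ dom′ =
    MinDom-no-smaller {H = L} minD dom′ (──＋-smaller {D} Dw₁ Dw₂ w₂≢w₁)

  no-three-in-fibre : ∀ {i a b c} → a ≢ b → a ≢ c → b ≢ c →
    D (i , a) ≡ true → D (i , b) ≡ true → D (i , c) ≡ true → ⊥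
  no-three-in-fibre {i} {a} {b} {c} a≢b a≢c b≢c Da Db Dc =
    no-Dom-──＋ Db Dc (pair-≢ (b≢c ∘ sym)) (Dom-fibrewise {D = D} dom repaired)
    where
    j = proj₁ (neighbour i)
    D′ : Subset L
    D′ = D ─ (i , b) ─ (i , c) ＋ (j , point j)
    i-repaired : FibreRepaired total D′ i
    i-repaired = (a , ──＋-keeps {D} Da (pair-≢ a≢b) (pair-≢ a≢c)) ,
                 λ e _ → (j , point j) , ＋-new {D ─ (i , b) ─ (i , c)} ,
                         G-adj⇒lexAdj (proj₂ (neighbour i)) e (point j)
    repaired : ∀ {k e} → D (k , e) ≡ true → D′ (k , e) ≡ false → FibreRepaired total D′ k
    repaired Dke D′ke with ──＋-dropped {D} Dke D′ke
    ... | inj₁ refl = i-repaired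
    ... | inj₂ refl = i-repaired

  cardIn≤2 : ∀ i → cardIn G F D i ≤ 2
  cardIn≤2 i with cardIn G F D i ≤? 2
  ... | yes ≤2 = ≤2
  ... | no  ≰2 =
    let a , b , c , a≢b , a≢c , b≢c , Da , Db , Dc =
          AllFinCount.count≥3⇒three (m i) (≰⇒> ≰2)
    in ⊥-elim (no-three-in-fibre a≢b a≢c b≢c Da Db Dc)

  two-in-fibre⇒no-D-neighbour : ∀ {s j a b c} → a ≢ b → D (s , a) ≡ true → D (s , b) ≡ true →
    D (j , c) ≡ true → j ≢ s → Graph.adj G s j ≡ false
  two-in-fibre⇒no-D-neighbour {s} {j} {a} {b} {c} a≢b Da Db Dc j≢s =
    ¬-not λ sj → no-Dom-─ Db (Dom-fibrewise {D = D} dom (repaired sj))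
    where
    D′ : Subset L
    D′ = D ─ (s , b)
    repaired : Graph.adj G s j ≡ true →
      ∀ {k e} → D (k , e) ≡ true → D′ (k , e) ≡ false → FibreRepaired total D′ k
    repaired sj Dke D′ke with ─-drops {D} D′ke
    ... | inj₁ Dke≡false = ⊥-elim (not-¬ Dke Dke≡false)
    ... | inj₂ refl      = (a , ─-keeps {D} Da (pair-≢ a≢b)) ,
                           λ e _ → (j , c) , ─-keeps {D} Dc (fst-≢ j≢s) , G-adj⇒lexAdj sj e c

  no-outer-D-neighbour : ∀ s → cardIn G F D s ≡ 2 →
    ∀ a (x : LexV G F) → D x ≡ true → proj₁ x ≢ s → lexAdj G F (s , a) x ≡ false
  no-outer-D-neighbour s c≡2 e (j , c) Dx j≢s =
    let a , b , a≢b , Da , Db = cardIn≡2⇒pair D s c≡2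
    in trans (lexAdj-across e c (j≢s ∘ sym)) (two-in-fibre⇒no-D-neighbour a≢b Da Db Dx j≢s)

  module _ (s : Fin n) (c≡2 : cardIn G F D s ≡ 2) where

    fibre-Dom : Dom total (toFG (F s)) (fibre G F D s)
    fibre-Dom e needs with dom (s , e) needs
    ... | (l , f) , Du , e~u with l Fin.≟ s
    ...   | yes refl = f , Du , trans (sym (lexAdj-within s e f)) e~u
    ...   | no  l≢s  = ⊥-elim (not-¬ e~u (no-outer-D-neighbour s c≡2 e (l , f) Du l≢s))

    single-dominator-impossible : ∀ {T} → Dom total (toFG (F s)) T → count T (allFin (m s)) ≤ 1 → ⊥
    single-dominator-impossible {T} domT ≤1 =
      let a , b , a≢b , Da , Db = cardIn≡2⇒pair D s c≡2
      in no-Dom-──＋ Da Db (pair-≢ (a≢b ∘ sym)) (Dom-fibrewise {D = D} dom (repaired a b))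
      where
      c₀ : Fin (m s)
      c₀ = proj₁ (Dom-nonempty {H = toFG (F s)} domT (point s))
      only-c₀ : ∀ {c} → T c ≡ true → c ≡ c₀
      only-c₀ Tc = AllFinCount.count≤1⇒unique (m s) {T} ≤1 Tc
        (proj₂ (Dom-nonempty {H = toFG (F s)} domT (point s)))
      s-repaired : ∀ a b → FibreRepaired total (D ─ (s , a) ─ (s , b) ＋ (s , c₀)) s
      s-repaired a b = (c₀ , D′c₀) , dominated
        where
        D′ : Subset L
        D′ = D ─ (s , a) ─ (s , b) ＋ (s , c₀)
        D′c₀ : D′ (s , c₀) ≡ true
        D′c₀ = ＋-new {D ─ (s , a) ─ (s , b)}
        needs-T : ∀ {e} → Needs total {L} D′ (s , e) → Needs total {toFG (F s)} T e
        needs-T (inj₁ tot) = inj₁ tot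
        needs-T (inj₂ D′e) =
          inj₂ (¬-not λ Te → not-¬ (subst (λ c → D′ (s , c) ≡ true) (sym (only-c₀ Te)) D′c₀) D′e)
        dominated : ∀ e → Needs total {L} D′ (s , e) →
          ∃ λ u → D′ u ≡ true × lexAdj G F (s , e) u ≡ true
        dominated e needs =
          let f , Tf , ef = domT e (needs-T needs)
          in (s , c₀) , D′c₀ ,
             trans (lexAdj-within s e c₀) (subst (λ c → Graph.adj (F s) e c ≡ true) (only-c₀ Tf) ef)
      repaired : ∀ a b {k e} → D (k , e) ≡ true →
        (D ─ (s , a) ─ (s , b) ＋ (s , c₀)) (k , e) ≡ false →
        FibreRepaired total (D ─ (s , a) ─ (s , b) ＋ (s , c₀)) k
      repaired a b Dke D′ke with ──＋-dropped {D} Dke D′ke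
      ... | inj₁ refl = s-repaired a b
      ... | inj₂ refl = s-repaired a b

    fibre-MinDom : MinDom total (toFG (F s)) (fibre G F D s)
    fibre-MinDom = fibre-Dom , at-least-two
      where
      at-least-two : ∀ T → Dom total (toFG (F s)) T → cardIn G F D s ≤ card (toFG (F s)) T
      at-least-two T domT with 2 ≤? count T (allFin (m s))
      ... | yes 2≤ = subst (_≤ count T (allFin (m s))) (sym c≡2) 2≤
      ... | no  2≰ = ⊥-elim (single-dominator-impossible domT (≤-pred (≰⇒> 2≰)))

  module _ {i j : Fin n} (i≢j : i ≢ j) (i≡2 : cardIn G F D i ≡ 2) (j≡2 : cardIn G F D j ≡ 2) where

    full-fibres-nonadjacent : Graph.adj G i j ≡ false
    full-fibres-nonadjacent =
      let _ , b , _ , _ , Db = cardIn≡2⇒pair D j j≡2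
      in trans (sym (lexAdj-across (point i) b i≢j))
               (no-outer-D-neighbour i i≡2 (point i) (j , b) Db (i≢j ∘ sym))

    no-common-neighbour : ∀ {k} → Graph.adj G i k ≡ true → Graph.adj G k j ≡ true → ⊥
    no-common-neighbour {k} ik kj with cardIn≡2⇒pair D i i≡2 | cardIn≡2⇒pair D j j≡2
    ... | ai , bi , ai≢bi , Dai , Dbi | aj , bj , aj≢bj , Daj , Dbj =
      no-Dom-──＋ Dbi Dbj (fst-≢ (i≢j ∘ sym)) (Dom-fibrewise {D = D} dom repaired)
      where
      D′ : Subset L
      D′ = D ─ (i , bi) ─ (j , bj) ＋ (k , point k)
      next-to-k : ∀ {l a} → Graph.adj G l k ≡ true → D′ (l , a) ≡ true → FibreRepaired total D′ l
      next-to-k {a = a} lk D′la =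
        (a , D′la) ,
        λ e _ → (k , point k) , ＋-new {D ─ (i , bi) ─ (j , bj)} , G-adj⇒lexAdj lk e (point k)
      repaired : ∀ {l e} → D (l , e) ≡ true → D′ (l , e) ≡ false → FibreRepaired total D′ l
      repaired Dle D′le with ──＋-dropped {D} Dle D′le
      ... | inj₁ refl = next-to-k ik (──＋-keeps {D} Dai (pair-≢ ai≢bi) (fst-≢ i≢j))
      ... | inj₂ refl =
        next-to-k (G-adj-sym kj) (──＋-keeps {D} Daj (fst-≢ (i≢j ∘ sym)) (pair-≢ aj≢bj))

    full-fibres-far : ∀ a b → DistAtLeast3 G F (i , a) (j , b)
    full-fibres-far a b =
      fst-≢ i≢j , trans (lexAdj-across a b i≢j) full-fibres-nonadjacent , no-path-of-length-two
      where
      no-path-of-length-two : ∀ w → lexAdj G F (i , a) w ≡ true → lexAdj G F w (j , b) ≡ false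
      no-path-of-length-two (k , c) iw with k Fin.≟ i | k Fin.≟ j
      ... | yes refl | yes i≡j  = ⊥-elim (i≢j i≡j)
      ... | yes refl | no  _    = full-fibres-nonadjacent
      ... | no  k≢i  | yes refl =
        ⊥-elim (not-¬ (trans (sym (lexAdj-across a c i≢j)) iw) full-fibres-nonadjacent)
      ... | no  k≢i  | no  k≢j  =
        ¬-not λ wj → no-common-neighbour (lexAdj⇒G-adj iw (k≢i ∘ sym)) wj

module DstarMembership {n : ℕ} (G : Graph n) {m : Fin n → ℕ} (F : (i : Fin n) → Graph (m i))
  (D : Subset (Lex G F)) (z₂ : (i : Fin n) → Fin (m i)) (x : Fin n → LexV G F) where

  R : Fin n → Bool
  R = inR G F D

  Kept : LexV G F → Bool
  Kept (j , b) = D (j , b) ∧ not (R j ∧ does (b Fin.≟ z₂ j))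

  D* : Subset (Lex G F)
  D* = Dstar G F D z₂ x

  kept-unless-z₂ : ∀ {j b} → D (j , b) ≡ true → b ≢ z₂ j ⊎ R j ≡ false → Kept (j , b) ≡ true
  kept-unless-z₂ {j} Djb (inj₁ b≢z₂) rewrite Djb | FinEq.≢⇒≡ᵇ-false b≢z₂ | ∧-zeroʳ (R j) = refl
  kept-unless-z₂     Djb (inj₂ ¬Rj)  rewrite Djb | ¬Rj = refl

  Dstar-kept : ∀ {v} → Kept v ≡ true → D* v ≡ true
  Dstar-kept {j , b} = ∨-true⇐ˡ

  -- The mark of x i in D* only computes once x i is a literal pair, so we refute the case
  -- in which it is unmarked.
  Dstar-added : ∀ {i} → R i ≡ true → D* (x i) ≡ true
  Dstar-added {i} Ri with x i in xi≡
  ... | j , b with D* (j , b) in D*jb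
  ...   | true  = refl
  ...   | false with foldr-∨-false⇒ (allFin n) (∨-conicalʳ (Kept (j , b)) _ D*jb) (∈-allFin i)
  ...     | unmarked with x i | xi≡ | unmarked
  ...       | .(j , b) | refl | unmarked′ with j Fin.≟ j | unmarked′
  ...         | no  j≢j  | _         = ⊥-elim (j≢j refl)
  ...         | yes refl | unmarked″ with b Fin.≟ b | unmarked″
  ...           | no  b≢b  | _ = ⊥-elim (b≢b refl)
  ...           | yes refl | unmarked‴ = ⊥-elim (not-¬ (cong (_∧ true) Ri) unmarked‴)

  Dstar⁻ : ∀ {j b} → D* (j , b) ≡ true →
    Kept (j , b) ≡ true ⊎ ∃ λ i → R i ≡ true × x i ≡ (j , b)
  Dstar⁻ {j} {b} D*jb with ∨-true⇒ (Kept (j , b)) D*jb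
  ... | inj₁ K      = inj₁ K
  ... | inj₂ marked with foldr-∨-true⇒ (allFin n) marked
  ...   | i , mark with x i in xi≡ | ∧-conicalˡ (R i) _ mark | ∧-conicalʳ (R i) _ mark
  ...     | k , c | Ri | same-vertex with k Fin.≟ j | same-vertex
  ...       | no  _    | ()
  ...       | yes refl | same-vertex′ with c Fin.≟ b | same-vertex′
  ...         | no  _    | ()
  ...         | yes refl | _ = inj₂ (i , Ri , xi≡)

module Replacement {n : ℕ} (G : Graph n) {m : Fin n → ℕ} (F : (i : Fin n) → Graph (m i))
  (neighbour : ∀ i → ∃ λ j → Graph.adj G i j ≡ true) (point : ∀ i → Fin (m i))
  {total : Bool} {D : Subset (Lex G F)} (minD : MinDom total (Lex G F) D)
  (z₂ : (i : Fin n) → Fin (m i)) (x : Fin n → LexV G F)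
  (z₂∈D : ∀ i → cardIn G F D i ≡ 2 → D (i , z₂ i) ≡ true)
  (x-near : ∀ i → cardIn G F D i ≡ 2 → proj₁ (x i) ≢ i × lexAdj G F (i , z₂ i) (x i) ≡ true) where

  open LexProduct G F
  open MinimumDominatingSet G F neighbour point minD
  open DstarMembership G F D z₂ x

  R⇒full : ∀ {i} → R i ≡ true → cardIn G F D i ≡ 2
  R⇒full {i} = does-true (cardIn G F D i ℕ.≟ 2)

  full⇒R : ∀ {i} → cardIn G F D i ≡ 2 → R i ≡ true
  full⇒R {i} = dec-true (cardIn G F D i ℕ.≟ 2)

  G-adj-x : ∀ {i} → R i ≡ true → Graph.adj G i (proj₁ (x i)) ≡ true
  G-adj-x {i} Ri = let xi≢i , z~x = x-near i (R⇒full Ri) in lexAdj⇒G-adj z~x (xi≢i ∘ sym)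

  x-fibre-D-free : ∀ {i} → R i ≡ true → ∀ g → D (proj₁ (x i) , g) ≡ false
  x-fibre-D-free {i} Ri g = ¬-not λ Dg →
    not-¬ (G-adj⇒lexAdj (G-adj-x Ri) (z₂ i) g)
          (no-outer-D-neighbour i (R⇒full Ri) (z₂ i) (proj₁ (x i) , g) Dg (proj₁ (x-near i (R⇒full Ri))))

  x-fibres-distinct : ∀ {i i′} → R i ≡ true → R i′ ≡ true → i ≢ i′ → proj₁ (x i) ≢ proj₁ (x i′)
  x-fibres-distinct {i} {i′} Ri Ri′ i≢i′ same = not-¬ x~z′ no-path
    where
    x~z′ : lexAdj G F (x i) (i′ , z₂ i′) ≡ true
    x~z′ = G-adj⇒lexAdj (subst (λ l → Graph.adj G l i′ ≡ true) (sym same) (G-adj-sym (G-adj-x Ri′)))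
                        (proj₂ (x i)) (z₂ i′)
    no-path : lexAdj G F (x i) (i′ , z₂ i′) ≡ false
    no-path = proj₂ (proj₂ (full-fibres-far i≢i′ (R⇒full Ri) (R⇒full Ri′) (z₂ i) (z₂ i′)))
                (x i) (proj₂ (x-near i (R⇒full Ri)))

  lost⇒z₂ : ∀ {j b} → D (j , b) ≡ true → D* (j , b) ≡ false → R j ≡ true × b ≡ z₂ j
  lost⇒z₂ {j} {b} Djb D*jb =
    let unkept = ∨-conicalˡ (Kept (j , b)) _ D*jb
        marked = not-injective (trans (cong (_∧ not (R j ∧ does (b Fin.≟ z₂ j))) (sym Djb)) unkept)
    in ∧-conicalˡ (R j) _ marked , FinEq.≡ᵇ-true⇒≡ (∧-conicalʳ (R j) _ marked)

  Dstar-Dom : Dom total L D*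
  Dstar-Dom = Dom-fibrewise {D = D} dom repaired
    where
    repaired : ∀ {j b} → D (j , b) ≡ true → D* (j , b) ≡ false → FibreRepaired total D* j
    repaired {j} Djb D*jb =
      let Rj , _ = lost⇒z₂ Djb D*jb
          a , a≢z₂ , Da = AllFinCount.count≥2⇒other (m j)
                            (≤-reflexive (sym (R⇒full Rj))) (z₂∈D j (R⇒full Rj))
      in (a , Dstar-kept (kept-unless-z₂ Da (inj₁ a≢z₂))) ,
         λ e _ → x j , Dstar-added Rj , G-adj⇒lexAdj (G-adj-x Rj) e (proj₂ (x j))

  hit : Fin n → Fin n → Bool
  hit i r = R i ∧ (proj₁ (x i) FinEq.≡ᵇ r)

  hits : Fin n → ℕ
  hits r = count (λ i → hit i r) (allFin n)

  ∑hits : ∑[ r < n ] hits r ≡ count R (allFin n)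
  ∑hits = begin
    ∑[ r < n ] hits r                       ≡⟨ sum-cong-≗ (λ r → count-allFin (λ i → hit i r)) ⟩
    ∑[ r < n ] ∑[ i < n ] indicator (hit i r) ≡⟨ ∑-comm (λ r i → indicator (hit i r)) ⟩
    ∑[ i < n ] ∑[ r < n ] indicator (hit i r) ≡⟨ sum-cong-≗ (λ i → point-mass (R i) (proj₁ (x i))) ⟩
    ∑[ i < n ] indicator (R i)              ≡⟨ count-allFin R ⟨
    count R (allFin n)                      ∎
    where
    open ≡-Reasoning
    point-mass : ∀ b c → ∑[ r < n ] indicator (b ∧ (c FinEq.≡ᵇ r)) ≡ indicator b
    point-mass false c =
      trans (sym (count-allFin {n} (λ _ → false))) (count-all-false (λ _ → refl) (allFin n))
    point-mass true  c = begin
      ∑[ r < n ] indicator (c FinEq.≡ᵇ r)   ≡⟨ count-allFin (c FinEq.≡ᵇ_) ⟨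
      count (c FinEq.≡ᵇ_) (allFin n)       ≡⟨ count-cong (FinEq.≡ᵇ-sym c) (allFin n) ⟩
      count (FinEq._≡ᵇ c) (allFin n)       ≡⟨ allFin-enumerates n c ⟩
      1                                       ∎

  unhit-fibre : ∀ {r} → (∀ i → R i ≡ true → proj₁ (x i) ≢ r) → ∀ b → D* (r , b) ≡ Kept (r , b)
  unhit-fibre {r} unhit b = ⇔→≡ {z = true} (mk⇔ only-kept Dstar-kept)
    where
    only-kept : D* (r , b) ≡ true → Kept (r , b) ≡ true
    only-kept D*rb with Dstar⁻ D*rb
    ... | inj₁ K             = K
    ... | inj₂ (i , Ri , x≡) = ⊥-elim (unhit i Ri (cong proj₁ x≡))

  full-fibre-card : ∀ {r} → R r ≡ true → cardIn G F D* r ≡ 1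
  full-fibre-card {r} Rr = suc-injective (begin
    suc (cardIn G F D* r)                                    ≡⟨ cong suc (count-cong kept (allFin (m r))) ⟩
    suc (count (fibre G F D r FinEq.─ z₂ r) (allFin (m r)))  ≡⟨ AllFinCount.count-─ (m r) (z₂∈D r full) ⟩
    cardIn G F D r                                           ≡⟨ full ⟩
    2                                                        ∎)
    where
    open ≡-Reasoning
    full = R⇒full Rr
    unhit : ∀ i → R i ≡ true → proj₁ (x i) ≢ r
    unhit i Ri refl = not-¬ (z₂∈D r full) (x-fibre-D-free Ri (z₂ r))
    kept : ∀ b → D* (r , b) ≡ (fibre G F D r FinEq.─ z₂ r) b
    kept b = trans (unhit-fibre unhit b) (cong (λ c → D (r , b) ∧ not (c ∧ does (b Fin.≟ z₂ r))) Rr)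

  partial-fibre-card : ∀ {r g} → R r ≡ false → D (r , g) ≡ true → cardIn G F D* r ≡ cardIn G F D r
  partial-fibre-card {r} {g} ¬Rr Drg = count-cong kept (allFin (m r))
    where
    unhit : ∀ i → R i ≡ true → proj₁ (x i) ≢ r
    unhit i Ri refl = not-¬ Drg (x-fibre-D-free Ri g)
    kept : ∀ b → D* (r , b) ≡ D (r , b)
    kept b = trans (unhit-fibre unhit b)
      (trans (cong (λ c → D (r , b) ∧ not (c ∧ does (b Fin.≟ z₂ r))) ¬Rr) (∧-identityʳ (D (r , b))))

  D-free-fibre-bound : ∀ {r} → (∀ g → D (r , g) ≡ false) →
    cardIn G F D* r ≤ 1 × cardIn G F D* r ≤ hits r
  D-free-fibre-bound {r} D-free = ≤1 , ≤hits
    where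
    added : ∀ {b} → D* (r , b) ≡ true → ∃ λ i → R i ≡ true × x i ≡ (r , b)
    added {b} D*rb with Dstar⁻ D*rb
    ... | inj₁ K   = ⊥-elim (not-¬ (∧-conicalˡ (D (r , b)) _ K) (D-free b))
    ... | inj₂ hit = hit
    same : ∀ {b b′} → D* (r , b) ≡ true → D* (r , b′) ≡ true → b ≡ b′
    same D*rb D*rb′ with added D*rb | added D*rb′
    ... | i , Ri , x≡ | i′ , Ri′ , x≡′ with i Fin.≟ i′
    ...   | yes refl = pair-injective (trans (sym x≡) x≡′)
    ...   | no  i≢i′ =
      ⊥-elim (x-fibres-distinct Ri Ri′ i≢i′ (trans (cong proj₁ x≡) (sym (cong proj₁ x≡′))))
    ≤1 : cardIn G F D* r ≤ 1
    ≤1 = AllFinCount.pairwise-equal⇒count≤1 (m r) same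
    ≤hits : cardIn G F D* r ≤ hits r
    ≤hits with cardIn G F D* r ≤? 0
    ... | yes ≤0 = ≤-trans ≤0 z≤n
    ... | no  ≰0 =
      let b , D*rb = count≥1⇒∃ (allFin (m r)) (≰⇒> ≰0)
          i , Ri , x≡ = added D*rb
      in ≤-trans ≤1 (AllFinCount.member⇒count≥1 n {a = i}
           (cong₂ _∧_ Ri (trans (cong (FinEq._≡ᵇ r) (cong proj₁ x≡)) (FinEq.≡ᵇ-refl r))))

  fibre-bound : ∀ r → cardIn G F D* r ≤ 1 × cardIn G F D* r + indicator (R r) ≤ cardIn G F D r + hits r
  fibre-bound r = by-cases (R r) refl (FinP.any? (λ g → D (r , g) Data.Bool.≟ true))
    where
    open ≤-Reasoning
    by-cases : ∀ ρ → R r ≡ ρ → Dec (∃ λ g → D (r , g) ≡ true) →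
      cardIn G F D* r ≤ 1 × cardIn G F D* r + indicator (R r) ≤ cardIn G F D r + hits r
    by-cases true Rr _ = ≤-reflexive (full-fibre-card Rr) , (begin
      cardIn G F D* r + indicator (R r) ≡⟨ cong₂ _+_ (full-fibre-card Rr) (cong indicator Rr) ⟩
      2                                 ≡⟨ R⇒full Rr ⟨
      cardIn G F D r                    ≤⟨ m≤m+n _ _ ⟩
      cardIn G F D r + hits r           ∎)
    by-cases false ¬Rr (yes (g , Drg)) = subst (_≤ 1) (sym same) ≤1 , (begin
      cardIn G F D* r + indicator (R r) ≡⟨ cong₂ _+_ same (cong indicator ¬Rr) ⟩
      cardIn G F D r + 0                ≤⟨ +-monoʳ-≤ (cardIn G F D r) z≤n ⟩
      cardIn G F D r + hits r           ∎)
      where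
      same = partial-fibre-card ¬Rr Drg
      ≤1 : cardIn G F D r ≤ 1
      ≤1 = ≤-pred (≤∧≢⇒< (cardIn≤2 r) (λ full → not-¬ (full⇒R full) ¬Rr))
    by-cases false ¬Rr (no none) = ≤1 , (begin
      cardIn G F D* r + indicator (R r) ≡⟨ cong (cardIn G F D* r +_) (cong indicator ¬Rr) ⟩
      cardIn G F D* r + 0               ≡⟨ +-identityʳ _ ⟩
      cardIn G F D* r                   ≤⟨ ≤hits ⟩
      hits r                            ≡⟨ cong (_+ hits r) (count-all-false D-free (allFin (m r))) ⟨
      cardIn G F D r + hits r           ∎)
      where
      D-free : ∀ g → D (r , g) ≡ false
      D-free g = ¬-not (λ Drg → none (g , Drg))
      ≤1 = proj₁ (D-free-fibre-bound D-free)
      ≤hits = proj₂ (D-free-fibre-bound D-free)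

  Dstar-no-larger : card L D* ≤ card L D
  Dstar-no-larger = +-cancelʳ-≤ |R| (card L D*) (card L D) (begin
    card L D* + |R|
      ≡⟨ cong₂ _+_ (card≡∑cardIn D*) (count-allFin R) ⟩
    ∑[ r < n ] cardIn G F D* r + ∑[ r < n ] indicator (R r)
      ≡⟨ ∑-distrib-+ (cardIn G F D*) (indicator ∘ R) ⟨
    ∑[ r < n ] (cardIn G F D* r + indicator (R r))
      ≤⟨ sum-mono-≤ (proj₂ ∘ fibre-bound) ⟩
    ∑[ r < n ] (cardIn G F D r + hits r)
      ≡⟨ ∑-distrib-+ (cardIn G F D) hits ⟩
    ∑[ r < n ] cardIn G F D r + ∑[ r < n ] hits r
      ≡⟨ cong₂ _+_ (card≡∑cardIn D) (sym ∑hits) ⟨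
    card L D + |R|
      ∎)
    where
    open ≤-Reasoning
    |R| = count R (allFin n)

  Dstar-MinDom : MinDom total L D*
  Dstar-MinDom = Dstar-Dom , λ T domT → ≤-trans Dstar-no-larger (proj₂ minD T domT)

  Dstar-cardIn≤1 : ∀ r → cardIn G F D* r ≤ 1
  Dstar-cardIn≤1 = proj₁ ∘ fibre-bound

connected⇒neighbour : ∀ {n} {G : Graph n} → 2 ≤ n → Connected (toFG G) →
  ∀ i → ∃ λ j → Graph.adj G i j ≡ true
connected⇒neighbour {G = G} 2≤n conn i = first-step (conn i (other 2≤n i)) (other-≢ 2≤n i)
  where
  other : ∀ {n} → 2 ≤ n → Fin n → Fin n
  other (s≤s (s≤s _)) zero    = suc zero
  other (s≤s (s≤s _)) (suc _) = zero
  other-≢ : ∀ {n} (2≤n : 2 ≤ n) (i : Fin n) → i ≢ other 2≤n i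
  other-≢ (s≤s (s≤s _)) zero    ()
  other-≢ (s≤s (s≤s _)) (suc _) ()
  first-step : ∀ {k} → Walk (toFG G) (λ _ → ⊤) i k → i ≢ k → ∃ λ j → Graph.adj G i j ≡ true
  first-step (here _)              i≢i = ⊥-elim (i≢i refl)
  first-step (step {y = j} _ ij _) _   = j , ij

module SparseSets {n : ℕ} (G : Graph n) {m : Fin n → ℕ} (F : (i : Fin n) → Graph (m i))
  (neighbour : ∀ i → ∃ λ j → Graph.adj G i j ≡ true) (2≤m : ∀ i → 2 ≤ m i)
  {U : Subset (Lex G F)} (U≤1 : ∀ i → cardIn G F U i ≤ 1) where

  open LexProduct G F

  free-vertex : ∀ j → ∃ λ e → U (j , e) ≡ false
  free-vertex j = count<length⇒∃ (allFin (m j))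
    (subst (cardIn G F U j <_) (sym (length-tabulate (λ a → a))) (≤-trans (s≤s (U≤1 j)) (2≤m j)))

  restrained : RestrainedCond L U
  restrained (k , c) _ =
    let j , kj = neighbour k
        e , Uje = free-vertex j
    in (j , e) , Uje , G-adj⇒lexAdj kj c e

  outer-connected : Connected (toFG G) → OuterConnCond L U
  outer-connected conn (k , c) (l , d) Ukc Uld = lift (conn k l) c d Ukc Uld
    where
    lift : ∀ {k l} → Walk (toFG G) (λ _ → ⊤) k l → ∀ c d → U (k , c) ≡ false → U (l , d) ≡ false →
      Walk L (λ v → U v ≡ false) (k , c) (l , d)
    lift {k} (here _) c d Ukc Ukd =
      let j , kj = neighbour k
          e , Uje = free-vertex j
      in step Ukc (G-adj⇒lexAdj kj c e) (step Uje (G-adj⇒lexAdj (G-adj-sym kj) e d) (here Ukd))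
    lift (step {y = j} _ kj walk) c d Ukc Uld =
      let e , Uje = free-vertex j
      in step Ukc (G-adj⇒lexAdj kj c e) (lift walk e d Uje Uld)

  total-dominating : Dominating L U →
    (∀ i (T : Subset (toFG (F i))) → Dominating (toFG (F i)) T → 2 ≤ card (toFG (F i)) T) →
    TotalDominating L U
  total-dominating domU γF≥2 (k , c)
    with FinP.¬∀⟶∃¬ (m k) DominatedInFibre dominated? fibre-not-dominating
    where
    DominatedInFibre : Fin (m k) → Set
    DominatedInFibre b = U (k , b) ≡ false → ∃ λ e → U (k , e) ≡ true × Graph.adj (F k) b e ≡ true
    dominated? : ∀ b → Dec (DominatedInFibre b)
    dominated? b = (U (k , b) Data.Bool.≟ false) →-dec
      FinP.any? (λ e → (U (k , e) Data.Bool.≟ true) ×-dec (Graph.adj (F k) b e Data.Bool.≟ true))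
    fibre-not-dominating : ¬ (∀ b → DominatedInFibre b)
    fibre-not-dominating dom = <-irrefl refl (≤-trans (γF≥2 k (fibre G F U k) dom) (U≤1 k))
  ... | b , undominated with U (k , b) in Ukb
  ...   | true  = ⊥-elim (undominated (λ ()))
  ...   | false with domU (k , b) Ukb
  ...     | (l , f) , Ulf , b~lf with k Fin.≟ l
  ...       | yes refl = ⊥-elim (undominated (λ _ → f , Ulf , b~lf))
  ...       | no  _    = (l , f) , Ulf , G-adj⇒lexAdj b~lf c f

module _ {n : ℕ} (G : Graph n) {m : Fin n → ℕ} (F : (i : Fin n) → Graph (m i))
  (neighbour : ∀ i → ∃ λ j → Graph.adj G i j ≡ true) (point : ∀ i → Fin (m i)) (total : Bool) where

  open LexProduct G F

  sparse-MinDom-exists : ∃ λ U → MinDom total L U × (∀ i → cardIn G F U i ≤ 1)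
  sparse-MinDom-exists =
    Dstar G F D z₂ x , Replacement.Dstar-MinDom G F neighbour point minD z₂ x z₂∈D x-near ,
                       Replacement.Dstar-cardIn≤1 G F neighbour point minD z₂ x z₂∈D x-near
    where
    everything-Dom : Dom total L (λ _ → true)
    everything-Dom (k , c) _ =
      let j , kj = neighbour k in (j , point j) , refl , G-adj⇒lexAdj kj c (point j)
    D : Subset L
    D = proj₁ (MinDom-exists {H = L} _≟ᵥ_ verts-complete everything-Dom)
    minD : MinDom total L D
    minD = proj₂ (MinDom-exists {H = L} _≟ᵥ_ verts-complete everything-Dom)
    z₂ : (i : Fin n) → Fin (m i)
    z₂ i with FinP.any? (λ a → D (i , a) Data.Bool.≟ true)
    ... | yes (a , _) = a
    ... | no  _       = point i
    z₂∈D : ∀ i → cardIn G F D i ≡ 2 → D (i , z₂ i) ≡ true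
    z₂∈D i full with FinP.any? (λ a → D (i , a) Data.Bool.≟ true)
    ... | yes (_ , Da) = Da
    ... | no  none     =
      ⊥-elim (none (count≥1⇒∃ (allFin (m i)) (subst (1 ≤_) (sym full) (s≤s z≤n))))
    x : Fin n → LexV G F
    x i = proj₁ (neighbour i) , point (proj₁ (neighbour i))
    x-near : ∀ i → cardIn G F D i ≡ 2 → proj₁ (x i) ≢ i × lexAdj G F (i , z₂ i) (x i) ≡ true
    x-near i _ = let ij = proj₂ (neighbour i) in G-adj⇒≢ ij ∘ sym , G-adj⇒lexAdj ij (z₂ i) (proj₂ (x i))

module Lemma2p6Parts {n : ℕ} (2≤n : 2 ≤ n) (G : Graph n) (conn : Connected (toFG G))
  {m : Fin n → ℕ} (F : (i : Fin n) → Graph (m i)) (2≤m : ∀ i → 2 ≤ m i) where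

  open LexProduct G F

  neighbour : ∀ i → ∃ λ j → Graph.adj G i j ≡ true
  neighbour = connected⇒neighbour {G = G} 2≤n conn

  point : ∀ i → Fin (m i)
  point i = fromℕ< (≤-trans (s≤s z≤n) (2≤m i))

  part-i : ∀ total (D : Subset L) → IsSet (paramOf total) L D →
    (∀ i → cardIn G F D i ≤ 2)
    × (∀ s → cardIn G F D s ≡ 2
         → (∀ a (x : LexV G F) → D x ≡ true → proj₁ x ≢ s → lexAdj G F (s , a) x ≡ false)
           × IsSet (paramOf total) (toFG (F s)) (fibre G F D s))
    × (∀ i j → i ≢ j → cardIn G F D i ≡ 2 → cardIn G F D j ≡ 2
         → ∀ a b → DistAtLeast3 G F (i , a) (j , b))
  part-i total D isD =
    cardIn≤2 ,
    (λ s full → no-outer-D-neighbour s full , MinDom⇒IsSet {H = toFG (F s)} total (fibre-MinDom s full)) ,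
    (λ i j i≢j i-full j-full → full-fibres-far i≢j i-full j-full)
    where open MinimumDominatingSet G F neighbour point (IsSet⇒MinDom {H = L} total isD)

  part-ii : ∀ total (D : Subset L) → IsSet (paramOf total) L D →
    (z₂ : (i : Fin n) → Fin (m i)) → (x : Fin n → LexV G F)
    → (∀ i → cardIn G F D i ≡ 2 → D (i , z₂ i) ≡ true)
    → (∀ i → cardIn G F D i ≡ 2 → proj₁ (x i) ≢ i × lexAdj G F (i , z₂ i) (x i) ≡ true)
    → IsSet (paramOf total) L (Dstar G F D z₂ x) × (∀ r → cardIn G F (Dstar G F D z₂ x) r ≤ 1)
  part-ii total D isD z₂ x z₂∈D x-near = MinDom⇒IsSet {H = L} total Dstar-MinDom , Dstar-cardIn≤1
    where open Replacement G F neighbour point (IsSet⇒MinDom {H = L} total isD) z₂ x z₂∈D x-near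

  restrainedOf outerConnectedOf : Bool → Param
  restrainedOf false = γr
  restrainedOf true  = γtr
  outerConnectedOf false = γoc
  outerConnectedOf true  = γtoc

  part-iii : ∀ total → ∃ λ (U : Subset L) → IsSet (paramOf total) L U × (∀ i → cardIn G F U i ≤ 1)
    × IsSet (restrainedOf total) L U × IsSet (outerConnectedOf total) L U
  part-iii total =
    let U , minU , U≤1 = sparse-MinDom-exists G F neighbour point total
        open SparseSets G F neighbour 2≤m U≤1
        isU = MinDom⇒IsSet {H = L} total minU
    in U , isU , U≤1 , inherit total isU restrained , inherit′ total isU (outer-connected conn)
    where
    inherit : ∀ total {U} → IsSet (paramOf total) L U → RestrainedCond L U →
      IsSet (restrainedOf total) L U
    inherit false isU r = IsSet-inherit {H = L} γ γr (λ _ → proj₁) (proj₁ isU , r) isU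
    inherit true  isU r = IsSet-inherit {H = L} γt γtr (λ _ → proj₁) (proj₁ isU , r) isU
    inherit′ : ∀ total {U} → IsSet (paramOf total) L U → OuterConnCond L U →
      IsSet (outerConnectedOf total) L U
    inherit′ false isU oc = IsSet-inherit {H = L} γ γoc (λ _ → proj₁) (proj₁ isU , oc) isU
    inherit′ true  isU oc = IsSet-inherit {H = L} γt γtoc (λ _ → proj₁) (proj₁ isU , oc) isU

  part-iv : (∀ i (T : Subset (toFG (F i))) → Dominating (toFG (F i)) T → 2 ≤ card (toFG (F i)) T)
    → ∀ (U : Subset L) → IsSet γ L U → (∀ i → cardIn G F U i ≤ 1)
    → IsSet γr L U → IsSet γoc L U
    → ∀ ν → (ν ≡ γr ⊎ ν ≡ γt ⊎ ν ≡ γtr ⊎ ν ≡ γoc ⊎ ν ≡ γtoc) → IsSet ν L U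
  part-iv γF≥2 U isU U≤1 isR isOC ν ν∈ = by-ν ν∈
    where
    total-dom : TotalDominating L U
    total-dom = SparseSets.total-dominating G F neighbour 2≤m U≤1 (proj₁ isU) γF≥2
    by-ν : ∀ {ν} → (ν ≡ γr ⊎ ν ≡ γt ⊎ ν ≡ γtr ⊎ ν ≡ γoc ⊎ ν ≡ γtoc) → IsSet ν L U
    by-ν (inj₁ refl)                               = isR
    by-ν (inj₂ (inj₁ refl))                        =
      IsSet-inherit {H = L} γ γt (λ T tot v _ → tot v) total-dom isU
    by-ν (inj₂ (inj₂ (inj₁ refl)))                 =
      IsSet-inherit {H = L} γ γtr (λ T tr v _ → proj₁ tr v) (total-dom , proj₂ (proj₁ isR)) isU
    by-ν (inj₂ (inj₂ (inj₂ (inj₁ refl))))          = isOC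
    by-ν (inj₂ (inj₂ (inj₂ (inj₂ refl))))          =
      IsSet-inherit {H = L} γ γtoc (λ T toc v _ → proj₁ toc v) (total-dom , proj₂ (proj₁ isOC)) isU

lemma2p6 : (n : ℕ) → 2 ≤ n → (G : Graph n) → Connected (toFG G)
    → (m : Fin n → ℕ) → (F : (i : Fin n) → Graph (m i)) → (∀ i → 2 ≤ m i)
    → (μ : Param) → (μ ≡ γ ⊎ μ ≡ γt)
    → (∀ (D : Subset (Lex G F)) → IsSet μ (Lex G F) D
        -- (i)
        → ((∀ i → cardIn G F D i ≤ 2)
          × (∀ s → cardIn G F D s ≡ 2
               → (∀ a (x : LexV G F) → D x ≡ true → proj₁ x ≢ s → lexAdj G F (s , a) x ≡ false)
                 × IsSet μ (toFG (F s)) (fibre G F D s))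
          × (∀ i j → i ≢ j → cardIn G F D i ≡ 2 → cardIn G F D j ≡ 2
               → ∀ a b → DistAtLeast3 G F (i , a) (j , b)))
        -- (ii)
        × ((∃ λ i → cardIn G F D i ≡ 2)
          → (z2 : (i : Fin n) → Fin (m i)) → (x : Fin n → LexV G F)
          → (∀ i → cardIn G F D i ≡ 2 → D (i , z2 i) ≡ true)
          → (∀ i → cardIn G F D i ≡ 2 → proj₁ (x i) ≢ i × lexAdj G F (i , z2 i) (x i) ≡ true)
          → IsSet μ (Lex G F) (Dstar G F D z2 x) × (∀ r → cardIn G F (Dstar G F D z2 x) r ≤ 1)))
      -- (iii)
      × (∃ λ (U : Subset (Lex G F)) → IsSet μ (Lex G F) U
          × (∀ i → cardIn G F U i ≤ 1)
          × (μ ≡ γ → IsSet γr (Lex G F) U × IsSet γoc (Lex G F) U)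
          × (μ ≡ γt → IsSet γtr (Lex G F) U × IsSet γtoc (Lex G F) U))
      -- (iv)
      × (μ ≡ γ → (∀ i (T : Subset (toFG (F i))) → Dominating (toFG (F i)) T → 2 ≤ card (toFG (F i)) T)
          → ∀ (U : Subset (Lex G F)) → IsSet γ (Lex G F) U
          → (∀ i → cardIn G F U i ≤ 1)
          → IsSet γr (Lex G F) U → IsSet γoc (Lex G F) U
          → ∀ ν → (ν ≡ γr ⊎ ν ≡ γt ⊎ ν ≡ γtr ⊎ ν ≡ γoc ⊎ ν ≡ γtoc)
          → IsSet ν (Lex G F) U)
-- Part (ii) does not need R ≠ ∅: for R = ∅ the set D* is D itself.
lemma2p6 n 2≤n G conn m F 2≤m .γ (inj₁ refl) =
  let U , isU , U≤1 , isR , isOC = part-iii false in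
  (λ D isD → part-i false D isD , λ _ → part-ii false D isD) ,
  (U , isU , U≤1 , (λ _ → isR , isOC) , λ ()) ,
  λ _ → part-iv
  where open Lemma2p6Parts 2≤n G conn F 2≤m
lemma2p6 n 2≤n G conn m F 2≤m .γt (inj₂ refl) =
  let U , isU , U≤1 , isR , isOC = part-iii true in
  (λ D isD → part-i true D isD , λ _ → part-ii true D isD) ,
  (U , isU , U≤1 , (λ ()) , λ _ → isR , isOC) ,
  λ ()
  where open Lemma2p6Parts 2≤n G conn F 2≤m
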